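{- In Domineering on the torus $\mathbb{Z}_2\times\mathbb{Z}_n$, the boards with $n=5$ and $n=9$ are second-player wins, and the board with $n=13$ is a win for Hepzibah.
   Context: Domineering is a two-player game: Vera places vertical dominoes (covering two vertically adjacent empty cells), Hepzibah places horizontal dominoes (covering two horizontally adjacent empty cells); they alternate, and a player unable to move on her turn loses. The $2\times n$ torus has cells $\mathbb{Z}_2\times\mathbb{Z}_n$ (2 rows, $n$ columns), with adjacency taken cyclically in both directions, so dominoes may wrap around both the top/bottom and the left/right edges. A position is a win for Hepzibah if she wins regardless of who moves first, and a second-player win if whoever moves second wins. -}

module Defs where

open import Data.Nat using (ℕ; suc; NonZero)
open import Data.Nat.DivMod using (_mod_)
open import Data.Fin using (Fin; zero; suc; toℕ; _≟_)
open import Data.Bool using (Bool; true; false; if_then_else_; _∧_)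
open import Data.Product using (Σ; _×_; _,_)
open import Relation.Nullary using (does)
open import Relation.Binary.PropositionalEquality using (_≡_)

-- Cells of the 2 × n torus Z₂ × Zₙ: a row in Fin 2, a column in Fin n.
-- A position records which cells are occupied (true = covered by a domino).
Position : ℕ → Set
Position n = Fin 2 → Fin n → Bool

emptyBoard : ∀ n → Position n
emptyBoard n r c = false

nextCol : ∀ {n} .{{_ : NonZero n}} → Fin n → Fin n
nextCol {n} c = suc (toℕ c) mod n

otherRow : Fin 2 → Fin 2
otherRow zero = suc zero
otherRow (suc zero) = zero

occupy : ∀ {n} → Fin 2 → Fin n → Position n → Position n
occupy r c s r' c' = if does (r' ≟ r) ∧ does (c' ≟ c) then true else s r' c'

data Player : Set where
  Vera Hepzibah : Player

opponent : Player → Player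
opponent Vera = Hepzibah
opponent Hepzibah = Vera

-- A move of a player is a domino, given by its "first" cell (r , c):
--  * Vera (vertical):     cells (r , c) and (r + 1 , c)
--  * Hepzibah (horizontal): cells (r , c) and (r , c + 1)
partner : ∀ {n} .{{_ : NonZero n}} → Player → Fin 2 → Fin n → Fin 2 × Fin n
partner Vera r c = otherRow r , c
partner Hepzibah r c = r , nextCol c

Legal : ∀ {n} .{{_ : NonZero n}} → Player → Position n → Fin 2 → Fin n → Set
Legal p s r c with partner p r c
... | r₂ , c₂ = (s r c ≡ false) × (s r₂ c₂ ≡ false)

play : ∀ {n} .{{_ : NonZero n}} → Player → Fin 2 → Fin n → Position n → Position n
play p r c s with partner p r c
... | r₂ , c₂ = occupy r₂ c₂ (occupy r c s)

-- Normal play: a player unable to move loses.  Since every move covers two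
-- more cells the game is finite, so inductive win/loss predicates suffice.
data WinsToMove {n} .{{_ : NonZero n}} : Player → Position n → Set
data LosesToMove {n} .{{_ : NonZero n}} : Player → Position n → Set

data WinsToMove {n} where
  win : ∀ {p s} (r : Fin 2) (c : Fin n) → Legal p s r c →
        LosesToMove (opponent p) (play p r c s) → WinsToMove p s

data LosesToMove {n} where
  lose : ∀ {p s} →
         ((r : Fin 2) (c : Fin n) → Legal p s r c →
            WinsToMove (opponent p) (play p r c s)) → LosesToMove p s

SecondPlayerWin : (n : ℕ) .{{_ : NonZero n}} → Set
SecondPlayerWin n = LosesToMove Vera (emptyBoard n) × LosesToMove Hepzibah (emptyBoard n)

HepzibahWin : (n : ℕ) .{{_ : NonZero n}} → Set
HepzibahWin n = LosesToMove Vera (emptyBoard n) × WinsToMove Hepzibah (emptyBoard n)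

-- The three outcomes are verified by exhaustive search of the game tree, run by evaluation: a
-- depth-bounded boolean search, proved sound for WinsToMove and LosesToMove, reduces to `true`
-- on the three empty boards. Vera's domino in column c covers the whole column whichever row it
-- starts in, so her moves are searched by column only, which halves her branching.
module Submission where

open import Defs
open import Data.Bool using (Bool; true; false; _∧_)
import Data.Bool.Properties as Bool
open import Data.Fin using (Fin; zero; suc; _≟_)
open import Data.Fin.Properties using (any?; all?)
open import Data.Nat using (ℕ; zero; suc; NonZero)
open import Data.Product using (_×_; _,_)
open import Data.Sum using (_⊎_; inj₁; inj₂)
open import Data.Vec using (Vec; lookup; updateAt; replicate; _[_]≔_)
open import Data.Vec.Properties using (lookup∘updateAt; lookup∘updateAt′; lookup-replicate)
open import Relation.Nullary using (Dec; yes; no; ¬_; does; contradiction)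
open import Relation.Nullary.Decidable using (_×-dec_; _⊎-dec_; ¬?)
open import Relation.Binary.PropositionalEquality using (_≡_; refl; sym; trans; cong)

witness : ∀ {a} {A : Set a} (a? : Dec A) → does a? ≡ true → A
witness (yes a) _ = a

module _ {n : ℕ} where

  _≈_ : Position n → Position n → Set
  s ≈ t = ∀ r c → s r c ≡ t r c

  ≈-sym : ∀ {s t} → s ≈ t → t ≈ s
  ≈-sym s≈t r c = sym (s≈t r c)

  ≈-trans : ∀ {s t u} → s ≈ t → t ≈ u → s ≈ u
  ≈-trans s≈t t≈u r c = trans (s≈t r c) (t≈u r c)

  occupy-cong : ∀ r c {s t} → s ≈ t → occupy r c s ≈ occupy r c t
  occupy-cong r c s≈t r′ c′ with does (r′ ≟ r) ∧ does (c′ ≟ c)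
  ... | true  = refl
  ... | false = s≈t r′ c′

  occupy-comm : ∀ r₁ c₁ r₂ c₂ s → occupy r₁ c₁ (occupy r₂ c₂ s) ≈ occupy r₂ c₂ (occupy r₁ c₁ s)
  occupy-comm r₁ c₁ r₂ c₂ s r c with does (r ≟ r₁) ∧ does (c ≟ c₁) | does (r ≟ r₂) ∧ does (c ≟ c₂)
  ... | true  | true  = refl
  ... | true  | false = refl
  ... | false | true  = refl
  ... | false | false = refl

-- The search runs on vectors rather than on the nested `occupy` closures of Defs, which keeps
-- cell lookups cheap when the search is evaluated.
Board : ℕ → Set
Board n = Vec (Vec Bool n) 2

module _ {n : ℕ} where

  ⟦_⟧ : Board n → Position n
  ⟦ v ⟧ r c = lookup (lookup v r) c

  blankBoard : Board n
  blankBoard = replicate 2 (replicate n false)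

  occupyBoard : Fin 2 → Fin n → Board n → Board n
  occupyBoard r c v = updateAt v r (_[ c ]≔ true)

  ⟦blankBoard⟧ : ⟦ blankBoard ⟧ ≈ emptyBoard n
  ⟦blankBoard⟧ r c =
    trans (cong (λ row → lookup row c) (lookup-replicate r (replicate n false))) (lookup-replicate c false)

  ⟦occupyBoard⟧ : ∀ r c v → ⟦ occupyBoard r c v ⟧ ≈ occupy r c ⟦ v ⟧
  ⟦occupyBoard⟧ r c v r′ c′ with r′ ≟ r | c′ ≟ c
  ... | yes refl | yes refl =
    trans (cong (λ row → lookup row c) (lookup∘updateAt r v)) (lookup∘updateAt c (lookup v r))
  ... | yes refl | no c′≢c =
    trans (cong (λ row → lookup row c′) (lookup∘updateAt r v)) (lookup∘updateAt′ c′ c c′≢c (lookup v r))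
  ... | no r′≢r | _ = cong (λ row → lookup row c′) (lookup∘updateAt′ r′ r r′≢r v)

module _ {n : ℕ} .{{_ : NonZero n}} where

  play-cong : ∀ p r c {s t : Position n} → s ≈ t → play p r c s ≈ play p r c t
  play-cong p r c s≈t with partner p r c
  ... | r₂ , c₂ = occupy-cong r₂ c₂ (occupy-cong r c s≈t)

  Legal-resp : ∀ p r c {s t : Position n} → s ≈ t → Legal p s r c → Legal p t r c
  Legal-resp p r c s≈t with partner p r c
  ... | r₂ , c₂ = λ (free₁ , free₂) → trans (sym (s≈t r c)) free₁ , trans (sym (s≈t r₂ c₂)) free₂

  mutual
    WinsToMove-resp : ∀ {p} {s t : Position n} → s ≈ t → WinsToMove p s → WinsToMove p t
    WinsToMove-resp {p} s≈t (win r c legal opponentLoses) =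
      win r c (Legal-resp p r c s≈t legal) (LosesToMove-resp (play-cong p r c s≈t) opponentLoses)

    LosesToMove-resp : ∀ {p} {s t : Position n} → s ≈ t → LosesToMove p s → LosesToMove p t
    LosesToMove-resp {p} s≈t (lose opponentWins) = lose λ r c legal →
      WinsToMove-resp (play-cong p r c s≈t) (opponentWins r c (Legal-resp p r c (≈-sym s≈t) legal))

  Legal-Vera-zero : ∀ r c (s : Position n) → Legal Vera s r c → Legal Vera s zero c
  Legal-Vera-zero zero       c s legal          = legal
  Legal-Vera-zero (suc zero) c s (free₁ , free₂) = free₂ , free₁

  play-Vera-zero : ∀ r c (s : Position n) → play Vera zero c s ≈ play Vera r c s
  play-Vera-zero zero       c s = λ _ _ → refl
  play-Vera-zero (suc zero) c s = occupy-comm (suc zero) c zero c s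

  playBoard : Player → Fin 2 → Fin n → Board n → Board n
  playBoard p r c v with partner p r c
  ... | r₂ , c₂ = occupyBoard r₂ c₂ (occupyBoard r c v)

  ⟦playBoard⟧ : ∀ p r c v → ⟦ playBoard p r c v ⟧ ≈ play p r c ⟦ v ⟧
  ⟦playBoard⟧ p r c v with partner p r c
  ... | r₂ , c₂ = ≈-trans (⟦occupyBoard⟧ r₂ c₂ (occupyBoard r c v)) (occupy-cong r₂ c₂ (⟦occupyBoard⟧ r c v))

  legal? : ∀ p (s : Position n) r c → Dec (Legal p s r c)
  legal? p s r c with partner p r c
  ... | r₂ , c₂ = (s r c Bool.≟ false) ×-dec (s r₂ c₂ Bool.≟ false)

  mutual
    wins : ℕ → Player → Board n → Bool
    wins zero    _        _ = false
    wins (suc k) Vera     v = does (any? λ c → winningMove? k Vera v zero c)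
    wins (suc k) Hepzibah v = does (any? λ r → any? λ c → winningMove? k Hepzibah v r c)

    loses : ℕ → Player → Board n → Bool
    loses zero    _        _ = false
    loses (suc k) Vera     v = does (all? λ c → refutedMove? k Vera v zero c)
    loses (suc k) Hepzibah v = does (all? λ r → all? λ c → refutedMove? k Hepzibah v r c)

    winningMove? : ∀ k p v r c → Dec (Legal p ⟦ v ⟧ r c × loses k (opponent p) (playBoard p r c v) ≡ true)
    winningMove? k p v r c = legal? p ⟦ v ⟧ r c ×-dec loses k (opponent p) (playBoard p r c v) Bool.≟ true

    refutedMove? : ∀ k p v r c → Dec (¬ Legal p ⟦ v ⟧ r c ⊎ wins k (opponent p) (playBoard p r c v) ≡ true)
    refutedMove? k p v r c = ¬? (legal? p ⟦ v ⟧ r c) ⊎-dec wins k (opponent p) (playBoard p r c v) Bool.≟ true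

  mutual
    wins-sound : ∀ k p v → wins k p v ≡ true → WinsToMove p ⟦ v ⟧
    wins-sound (suc k) Vera v found =
      let c , move = witness (any? λ c → winningMove? k Vera v zero c) found
      in winningMove-sound k Vera v zero c move
    wins-sound (suc k) Hepzibah v found =
      let r , c , move = witness (any? λ r → any? λ c → winningMove? k Hepzibah v r c) found
      in winningMove-sound k Hepzibah v r c move

    loses-sound : ∀ k p v → loses k p v ≡ true → LosesToMove p ⟦ v ⟧
    loses-sound (suc k) Vera v refuted = lose λ r c legal →
      WinsToMove-resp (play-Vera-zero r c ⟦ v ⟧)
        (refutedMove-sound k Vera v zero c (Legal-Vera-zero r c ⟦ v ⟧ legal)
          (witness (all? λ c → refutedMove? k Vera v zero c) refuted c))
    loses-sound (suc k) Hepzibah v refuted = lose λ r c legal →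
      refutedMove-sound k Hepzibah v r c legal
        (witness (all? λ r → all? λ c → refutedMove? k Hepzibah v r c) refuted r c)

    winningMove-sound : ∀ k p v r c → Legal p ⟦ v ⟧ r c × loses k (opponent p) (playBoard p r c v) ≡ true →
                        WinsToMove p ⟦ v ⟧
    winningMove-sound k p v r c (legal , refuted) =
      win r c legal (LosesToMove-resp (⟦playBoard⟧ p r c v) (loses-sound k (opponent p) (playBoard p r c v) refuted))

    refutedMove-sound : ∀ k p v r c → Legal p ⟦ v ⟧ r c →
                        ¬ Legal p ⟦ v ⟧ r c ⊎ wins k (opponent p) (playBoard p r c v) ≡ true →
                        WinsToMove (opponent p) (play p r c ⟦ v ⟧)
    refutedMove-sound k p v r c legal (inj₁ illegal) = contradiction legal illegal
    refutedMove-sound k p v r c legal (inj₂ found) =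
      WinsToMove-resp (⟦playBoard⟧ p r c v) (wins-sound k (opponent p) (playBoard p r c v) found)

secondPlayerWin-by-search : ∀ n .{{_ : NonZero n}} k →
  loses k Vera blankBoard ≡ true → loses k Hepzibah blankBoard ≡ true → SecondPlayerWin n
secondPlayerWin-by-search n k vera hepzibah =
  LosesToMove-resp ⟦blankBoard⟧ (loses-sound k Vera blankBoard vera) ,
  LosesToMove-resp ⟦blankBoard⟧ (loses-sound k Hepzibah blankBoard hepzibah)

hepzibahWin-by-search : ∀ n .{{_ : NonZero n}} k →
  loses k Vera blankBoard ≡ true → wins k Hepzibah blankBoard ≡ true → HepzibahWin n
hepzibahWin-by-search n k vera hepzibah =
  LosesToMove-resp ⟦blankBoard⟧ (loses-sound k Vera blankBoard vera) ,
  WinsToMove-resp ⟦blankBoard⟧ (wins-sound k Hepzibah blankBoard hepzibah)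

-- Every move covers two of the 2n cells, so a game lasts at most n moves and depth n + 1 suffices.
mainTheorem13 : SecondPlayerWin 5 × SecondPlayerWin 9 × HepzibahWin 13
mainTheorem13 =
  secondPlayerWin-by-search 5 6 refl refl ,
  secondPlayerWin-by-search 9 10 refl refl ,
  hepzibahWin-by-search 13 14 refl refl
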